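{- Let $S_1\subseteq V(5,3)$ be the set $S_1=\{\pm(1,0,0,0,0),\pm(0,0,1,0,1),\pm(0,1,0,1,0),\pm(0,1,2,0,0),\pm(0,0,1,2,1),\pm(0,1,0,1,2),\pm(1,1,2,0,2),\pm(1,0,0,1,2),\pm(1,0,2,1,0),\pm(1,1,0,0,2),\pm(1,1,2,1,0)\}$, and let $\Gamma=\mathrm{Cay}(V(5,3),S_1)$. Let $$x=\begin{pmatrix} 0 & 2 & 1 & 0 & 0 \\ 2 & 1 & 1 & 2 & 2 \\ 0 & 1 & 1 & 2 & 2 \\ 1 & 0 & 2 & 2 & 1 \\ 1 & 2 & 2 & 2 & 0\end{pmatrix}$$ over $\mathbb{F}_3$, and let $e$ be the $5\times 5$ identity matrix. Consider the maps $v\mapsto v(-e)=-v$ and $v\mapsto v(-x)$ on $V(5,3)$ (row vectors multiplied on the right); these are involutive automorphisms of $\Gamma$. Then: (1) the involution $v\mapsto -v$ interchanges some pair of adjacent vertices of $\Gamma$ and also some pair of non-adjacent vertices of $\Gamma$; (2) the involution $v\mapsto v(-x)$ interchanges some pair of adjacent vertices of $\Gamma$ and also some pair of non-adjacent vertices of $\Gamma$.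
   Context: $V(5,3)$ is the $5$-dimensional vector space of row vectors over $\mathbb{F}_3$. The Cayley graph $\mathrm{Cay}(V(5,3),S)$, for an inverse-closed $S\subseteq V(5,3)\setminus\{0\}$, has vertex set $V(5,3)$ with $u,w$ adjacent iff $u-w\in S$. An involution $\phi$ "interchanges" vertices $u\neq w$ if $\phi(u)=w$ (and $\phi(w)=u$). -}

module Defs where

open import Data.Fin using (Fin; zero; suc)
open import Data.Vec using (Vec; []; _∷_; zipWith; map; replicate; foldr)
open import Data.List using (List; []; _∷_; concatMap)
open import Data.List.Membership.Propositional using (_∈_)
open import Data.Product using (_×_; ∃-syntax)
open import Relation.Binary.PropositionalEquality using (_≡_; _≢_)
open import Relation.Nullary using (¬_)

F₃ : Set
F₃ = Fin 3

0F 1F 2F : F₃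
0F = zero
1F = suc zero
2F = suc (suc zero)

_+₃_ : F₃ → F₃ → F₃
zero +₃ y = y
suc zero +₃ zero = 1F
suc zero +₃ suc zero = 2F
suc zero +₃ suc (suc zero) = 0F
suc (suc zero) +₃ zero = 2F
suc (suc zero) +₃ suc zero = 0F
suc (suc zero) +₃ suc (suc zero) = 1F

-₃_ : F₃ → F₃
-₃ zero = 0F
-₃ suc zero = 2F
-₃ suc (suc zero) = 1F

_*₃_ : F₃ → F₃ → F₃
zero *₃ y = 0F
suc zero *₃ y = y
suc (suc zero) *₃ y = -₃ y

V : Set
V = Vec F₃ 5

_⊕_ : V → V → V
_⊕_ = zipWith _+₃_

⊖_ : V → V
⊖_ = map -₃_

_⊝_ : V → V → V
u ⊝ w = u ⊕ (⊖ w)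

-- 5×5 matrices over F_3, as a vector of 5 rows
Mat : Set
Mat = Vec V 5

-- row vector times matrix: v M = Σ_i v_i (row i of M)
_·_ : V → Mat → V
v · M = foldr (λ _ → V) _⊕_ (replicate 5 0F) (zipWith (λ c r → map (c *₃_) r) v M)

negMat : Mat → Mat
negMat = map ⊖_

xMat : Mat
xMat = (0F ∷ 2F ∷ 1F ∷ 0F ∷ 0F ∷ [])
     ∷ (2F ∷ 1F ∷ 1F ∷ 2F ∷ 2F ∷ [])
     ∷ (0F ∷ 1F ∷ 1F ∷ 2F ∷ 2F ∷ [])
     ∷ (1F ∷ 0F ∷ 2F ∷ 2F ∷ 1F ∷ [])
     ∷ (1F ∷ 2F ∷ 2F ∷ 2F ∷ 0F ∷ [])
     ∷ []

eMat : Mat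
eMat = (1F ∷ 0F ∷ 0F ∷ 0F ∷ 0F ∷ [])
     ∷ (0F ∷ 1F ∷ 0F ∷ 0F ∷ 0F ∷ [])
     ∷ (0F ∷ 0F ∷ 1F ∷ 0F ∷ 0F ∷ [])
     ∷ (0F ∷ 0F ∷ 0F ∷ 1F ∷ 0F ∷ [])
     ∷ (0F ∷ 0F ∷ 0F ∷ 0F ∷ 1F ∷ [])
     ∷ []

S₁gens : List V
S₁gens = (1F ∷ 0F ∷ 0F ∷ 0F ∷ 0F ∷ [])
       ∷ (0F ∷ 0F ∷ 1F ∷ 0F ∷ 1F ∷ [])
       ∷ (0F ∷ 1F ∷ 0F ∷ 1F ∷ 0F ∷ [])
       ∷ (0F ∷ 1F ∷ 2F ∷ 0F ∷ 0F ∷ [])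
       ∷ (0F ∷ 0F ∷ 1F ∷ 2F ∷ 1F ∷ [])
       ∷ (0F ∷ 1F ∷ 0F ∷ 1F ∷ 2F ∷ [])
       ∷ (1F ∷ 1F ∷ 2F ∷ 0F ∷ 2F ∷ [])
       ∷ (1F ∷ 0F ∷ 0F ∷ 1F ∷ 2F ∷ [])
       ∷ (1F ∷ 0F ∷ 2F ∷ 1F ∷ 0F ∷ [])
       ∷ (1F ∷ 1F ∷ 0F ∷ 0F ∷ 2F ∷ [])
       ∷ (1F ∷ 1F ∷ 2F ∷ 1F ∷ 0F ∷ [])
       ∷ []

S₁ : List V
S₁ = concatMap (λ s → s ∷ (⊖ s) ∷ []) S₁gens

Adj : List V → V → V → Set
Adj S u w = (u ⊝ w) ∈ S

Interchanges : (V → V) → V → V → Set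
Interchanges φ u w = (u ≢ w) × (φ u ≡ w) × (φ w ≡ u)

SwapsAdjAndNonAdj : List V → (V → V) → Set
SwapsAdjAndNonAdj S φ =
  (∃[ u ] ∃[ w ] (Interchanges φ u w × Adj S u w)) ×
  (∃[ u ] ∃[ w ] (Interchanges φ u w × ¬ Adj S u w))

{-# OPTIONS --safe #-}
module Submission where

open import Defs
open import Data.Fin.Properties using (_≟_)
open import Data.List using (List)
open import Data.List.Membership.DecPropositional using (_∈?_)
open import Data.Product using (_×_; _,_; ∃-syntax)
open import Data.Vec using ([]; _∷_)
open import Data.Vec.Properties using (≡-dec)
open import Relation.Binary.Definitions using (DecidableEquality)
open import Relation.Binary.PropositionalEquality using (_≡_; _≢_; refl)
open import Relation.Nullary using (Dec; ¬_)
open import Relation.Nullary.Decidable using (True; False; toWitness; toWitnessFalse)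

_≟V_ : DecidableEquality V
_≟V_ = ≡-dec _≟_

Adj? : (S : List V) → (u w : V) → Dec (Adj S u w)
Adj? S u w = _∈?_ _≟V_ (u ⊝ w) S

vec : F₃ → F₃ → F₃ → F₃ → F₃ → V
vec a b c d e = a ∷ b ∷ c ∷ d ∷ e ∷ []

module _ {S : List V} {φ : V → V} where

  interchangesAdjacent : (u w : V) → u ≢ w → φ u ≡ w → φ w ≡ u →
                         {True (Adj? S u w)} →
                         ∃[ u ] ∃[ w ] (Interchanges φ u w × Adj S u w)
  interchangesAdjacent u w u≢w φu≡w φw≡u {adj} =
    u , w , (u≢w , φu≡w , φw≡u) , toWitness adj

  interchangesNonAdjacent : (u w : V) → u ≢ w → φ u ≡ w → φ w ≡ u →
                            {False (Adj? S u w)} →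
                            ∃[ u ] ∃[ w ] (Interchanges φ u w × ¬ Adj S u w)
  interchangesNonAdjacent u w u≢w φu≡w φw≡u {nonAdj} =
    u , w , (u≢w , φu≡w , φw≡u) , toWitnessFalse nonAdj

-- In characteristic 3, u − (−u) = −u, so −e joins u and −u exactly when u ∈ S₁.
swapsAdjAndNonAdj-−e : SwapsAdjAndNonAdj S₁ (λ v → v · negMat eMat)
swapsAdjAndNonAdj-−e =
    interchangesAdjacent (vec 1F 0F 0F 0F 0F) (vec 2F 0F 0F 0F 0F) (λ ()) refl refl
  , interchangesNonAdjacent (vec 0F 1F 0F 0F 0F) (vec 0F 2F 0F 0F 0F) (λ ()) refl refl

swapsAdjAndNonAdj-−x : SwapsAdjAndNonAdj S₁ (λ v → v · negMat xMat)
swapsAdjAndNonAdj-−x =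
    interchangesAdjacent (vec 0F 1F 0F 0F 1F) (vec 0F 0F 0F 2F 1F) (λ ()) refl refl
  , interchangesNonAdjacent (vec 0F 0F 0F 0F 1F) (vec 2F 1F 1F 1F 0F) (λ ()) refl refl

lemma5 : SwapsAdjAndNonAdj S₁ (λ v → v · negMat eMat)
         × SwapsAdjAndNonAdj S₁ (λ v → v · negMat xMat)
lemma5 = swapsAdjAndNonAdj-−e , swapsAdjAndNonAdj-−x
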